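{- Let $\mathcal{A}=(n,k,\mathcal{C},\mathcal{T})$ be a grid tiling instance and let $G=G(\mathcal{A})$ be the signature graph described in the context (with any choice of the functions $f_\kappa$, $g_\kappa$ as specified there). Then the grid tilings of $\mathcal{A}$ correspond bijectively to the assignments $x\in\{0,1\}^{E(G)}$ with $\mathrm{val}_G(x)\neq0$, and every such assignment satisfies $\mathrm{val}_G(x)=1$.
   Context: Grid tiling instance: $n,k\in\mathbb{N}$, $\mathcal{C}\subseteq[k]^2$, and $\mathcal{T}$ assigning to each $\kappa\in\mathcal{C}$ a set $\mathcal{T}(\kappa)\subseteq[n]^2$. $(i,j),(i',j')\in[k]^2$ are horizontally adjacent if $i=i'$, $|j-j'|=1$, vertically adjacent if $j=j'$, $|i-i'|=1$. A grid tiling is $a:[k]^2\to[n]^2$ such that first components of $a(\kappa),a(\kappa')$ agree for horizontally adjacent $\kappa,\kappa'$, second components agree for vertically adjacent ones, and $a(\kappa)\in\mathcal{T}(\kappa)$ for $\kappa\in\mathcal{C}$. Signature graph: edge-weighted multigraph with a vertex function $f_v:\{0,1\}^{I(v)}\to\mathbb{C}$ per vertex $v$ ($I(v)$ = incident edges); for $x\in\{0,1\}^{E}$, $\mathrm{val}_G(x)=\prod_v f_v(x|_{I(v)})$. The graph $G(\mathcal{A})$: vertices $c_\kappa$ for $\kappa\in[k]^2\cup\{\mathsf N,\mathsf W,\mathsf S,\mathsf E\}\times[k]$. Besides the adjacencies within $[k]^2$, $(\mathsf N,j)$ is vertically adjacent to $(1,j)$, $(\mathsf S,j)$ to $(k,j)$,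 $(\mathsf W,i)$ horizontally adjacent to $(i,1)$, $(\mathsf E,i)$ to $(i,k)$. For every adjacent pair $\kappa,\kappa'$, $G$ has $n$ parallel edges between $c_\kappa,c_{\kappa'}$ (an edge bundle), numbered $1,\dots,n$, all of weight $1$. Each border vertex $c_\kappa$, $\kappa\in\{\mathsf N,\mathsf W,\mathsf S,\mathsf E\}\times[k]$, has vertex function $\mathrm{HW}_{=1}(z)=[\text{$z$ has exactly one }1]$. For $\kappa=(i,j)\in[k]^2$, the $4n$ incident edges of $c_\kappa$ are ordered: the bundle to its northern neighbour ($(i-1,j)$ or $(\mathsf N,j)$), then eastern, southern, western; an assignment $x\in\{0,1\}^{4n}$ is written $x=x_Nx_Ex_Sx_W$ with $x_N,x_E,x_S,x_W\in\{0,1\}^n$, the $t$-th bit being the value of the $t$-th edge of the bundle. A string $0^{v-1}10^{n-v}$ is identified with $v\in[n]$. Predicates: $\varphi_{one}(x)$: $x_N$ and $x_W$ each contain exactly one $1$; $\varphi_{prop}(x)$: $x_N=x_S$ and $x_W=x_E$. For $\kappa\in[k]^2\setminus\mathcal{C}$, the vertex function of $c_\kappa$ is some $f_\kappa:\{0,1\}^{4n}\to\{0,1\}$ with $f_\kappa(x)=[\varphi_{prop}(x)]$ for all $x$ satisfying $\varphi_{one}$ (arbitrary otherwise); for $\kappa\in\mathcal{C}$ it is some $g_\kappa:\{0,1\}^{4n}\to\{0,1\}$ with $g_\kappa(x)=[\varphi_{prop}(x)\wedge(x_W,x_N)\in\mathcal{T}(\kappa)]$ for all $x$ satisfying $\varphi_{one}$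 (arbitrary otherwise). -}

module Defs where

open import Data.Nat using (ℕ; zero; suc; _*_; _≡ᵇ_; _+_)
open import Data.Bool using (Bool; true; false; _∧_; if_then_else_)
open import Data.Fin using (Fin; zero; suc; toℕ; inject₁; fromℕ)
open import Data.Fin.Properties using () renaming (_≟_ to _≟ᶠ_)
open import Data.Vec using (Vec; []; _∷_; tabulate)
open import Data.Vec.Properties using (≡-dec)
open import Data.Bool.Properties using () renaming (_≟_ to _≟ᵇ_)
open import Data.Product using (_×_; proj₁; proj₂)
open import Relation.Nullary using (does)
open import Relation.Binary.PropositionalEquality using (_≡_)

-- The subset C ⊆ [k]^2 is given by its
-- characteristic function, and T κ ⊆ [n]^2 likewise (T κ is only ever
-- consulted for κ ∈ C).

Cells : ℕ → Set
Cells k = Fin k → Fin k → Bool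

Tiles : ℕ → ℕ → Set
Tiles n k = Fin k → Fin k → Fin n × Fin n → Bool

Tiling : ℕ → ℕ → Set
Tiling n k = Fin k → Fin k → Fin n × Fin n

record IsGridTiling {n k : ℕ} (C : Cells k) (T : Tiles n k) (a : Tiling n k) : Set where
  field
    horiz : ∀ i j j' → toℕ j' ≡ suc (toℕ j) → proj₁ (a i j) ≡ proj₁ (a i j')
    vert  : ∀ i i' j → toℕ i' ≡ suc (toℕ i) → proj₂ (a i j) ≡ proj₂ (a i' j)
    tiles : ∀ i j → C i j ≡ true → T i j (a i j) ≡ true

_≗ᵀ_ : {n k : ℕ} → Tiling n k → Tiling n k → Set
a ≗ᵀ b = ∀ i j → a i j ≡ b i j

-- Vertices: c_(i,j) for (i,j) ∈ [k]^2, and border vertices c_(N,j),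
-- c_(W,i), c_(S,j), c_(E,i).
-- Edges: for every adjacent pair an edge bundle of n parallel edges.
--   hor i p t : t-th edge of the horizontal bundle in row i at position p,
--     p = 0      : between c_(W,i) and c_(i,0)
--     0 < p < k  : between c_(i,p-1) and c_(i,p)
--     p = k      : between c_(i,k-1) and c_(E,i)
--   ver j p t : t-th edge of the vertical bundle in column j at position p,
--     p = 0      : between c_(N,j) and c_(0,j)
--     0 < p < k  : between c_(p-1,j) and c_(p,j)
--     p = k      : between c_(k-1,j) and c_(S,j)
-- (All edge weights are 1, so they play no role in val.)

data Edge (n k : ℕ) : Set where
  hor : (i : Fin k) (p : Fin (suc k)) (t : Fin n) → Edge n k
  ver : (j : Fin k) (p : Fin (suc k)) (t : Fin n) → Edge n k

Assignment : ℕ → ℕ → Set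
Assignment n k = Edge n k → Bool

_≗ᴱ_ : {n k : ℕ} → Assignment n k → Assignment n k → Set
x ≗ᴱ y = ∀ e → x e ≡ y e

-- Vertex functions of the inner vertices: f (x_N) (x_E) (x_S) (x_W)
InnerFunctions : ℕ → ℕ → Set
InnerFunctions n k =
  Fin k → Fin k → Vec Bool n → Vec Bool n → Vec Bool n → Vec Bool n → Bool

-- the string 0^{v-1} 1 0^{n-v} identified with v ∈ [n]
oneHot : {n : ℕ} → Fin n → Vec Bool n
oneHot v = tabulate (λ t → does (t ≟ᶠ v))

ones : {n : ℕ} → Vec Bool n → ℕ
ones []           = 0
ones (true ∷ xs)  = suc (ones xs)
ones (false ∷ xs) = ones xs

HW₌₁ : {n : ℕ} → Vec Bool n → Bool
HW₌₁ xs = ones xs ≡ᵇ 1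

_=ᵛ_ : {n : ℕ} → Vec Bool n → Vec Bool n → Bool
xs =ᵛ ys = does (≡-dec _≟ᵇ_ xs ys)

-- The requirement on the vertex functions of the inner vertices: whenever
-- φ_one(x) holds, i.e. x_N = v_N and x_W = v_W for some v_N, v_W ∈ [n],
--   κ ∉ C :  f_κ(x) = [φ_prop(x)]
--   κ ∈ C :  g_κ(x) = [φ_prop(x) ∧ (x_W , x_N) ∈ T(κ)]
-- (arbitrary otherwise).
Admissible : {n k : ℕ} → Cells k → Tiles n k → InnerFunctions n k → Set
Admissible {n} {k} C T F =
  ∀ (i j : Fin k) (vN vW : Fin n) (xE xS : Vec Bool n) →
    F i j (oneHot vN) xE xS (oneHot vW)
      ≡ ((oneHot vN =ᵛ xS) ∧ (oneHot vW =ᵛ xE)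
          ∧ (if C i j then T i j (vW , vN) else true))
  where open Data.Product using (_,_)

⟦_⟧ : Bool → ℕ
⟦ true ⟧  = 1
⟦ false ⟧ = 0

∏ : {m : ℕ} → (Fin m → ℕ) → ℕ
∏ {zero}  f = 1
∏ {suc m} f = f zero * ∏ (λ i → f (suc i))

bundleH : {n k : ℕ} → Assignment n k → Fin k → Fin (suc k) → Vec Bool n
bundleH x i p = tabulate (λ t → x (hor i p t))

bundleV : {n k : ℕ} → Assignment n k → Fin k → Fin (suc k) → Vec Bool n
bundleV x j p = tabulate (λ t → x (ver j p t))

innerVal : {n k : ℕ} → InnerFunctions n k → Assignment n k → Fin k → Fin k → ℕ
innerVal F x i j =
  ⟦ F i j (bundleV x j (inject₁ i))
          (bundleH x i (suc j))
          (bundleV x j (suc i))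
          (bundleH x i (inject₁ j)) ⟧

val : {n k : ℕ} → InnerFunctions n k → Assignment n k → ℕ
val {n} {k} F x =
  ∏ (λ i → ∏ (λ j → innerVal F x i j))
  * ∏ (λ j → ⟦ HW₌₁ (bundleV x j zero) ⟧)
  * ∏ (λ i → ⟦ HW₌₁ (bundleH x i zero) ⟧)
  * ∏ (λ j → ⟦ HW₌₁ (bundleV x j (fromℕ k)) ⟧)
  * ∏ (λ i → ⟦ HW₌₁ (bundleH x i (fromℕ k)) ⟧)

-- A nonzero product of 0/1-valued vertex functions equals 1 and forces every vertex function to be 1.
-- The HW₌₁ border conditions make the northern and western bundles of the first row and column
-- one-hot; an admissible cell with one-hot north and west bundles copies them to its south and east
-- bundles, so by induction over rows and columns every bundle is one-hot. Reading cell (i,j) as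
-- (west value, north value) then gives a grid tiling, and conversely a grid tiling encoded by
-- one-hot bundles satisfies every vertex function.
module Submission where

open import Defs
open import Data.Nat using (ℕ; zero; suc; _*_; _≤_; z≤n; _≡ᵇ_)
open import Data.Nat.Properties using (≤-refl; *-mono-≤; n≤1⇒n≡0∨n≡1; m*n≡1⇒m≡1; m*n≡1⇒n≡1; ≡ᵇ⇒≡; suc-injective; 1+n≢0)
open import Data.Fin using (Fin; zero; suc; toℕ; inject₁; fromℕ)
open import Data.Fin.Properties using (toℕ-injective; toℕ-inject₁) renaming (_≟_ to _≟ᶠ_)
open import Data.Fin.Induction using (<-weakInduction)
open import Data.Vec using (Vec; []; _∷_; tabulate; lookup)
open import Data.Vec.Properties using (lookup∘tabulate; tabulate-cong; ≡-dec)
open import Data.Bool using (Bool; true; false; _∧_; if_then_else_)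
open import Data.Bool.Properties using (∧-conicalˡ; ∧-conicalʳ; T-≡) renaming (_≟_ to _≟ᵇ_)
open import Data.Product using (Σ; ∃-syntax; _×_; _,_; proj₁; proj₂)
open import Data.Sum using (inj₁; inj₂)
open import Data.Empty using (⊥; ⊥-elim)
open import Function using (_∘_; const)
open import Function.Bundles using (_⇔_; mk⇔; Equivalence)
open import Relation.Nullary using (Dec; does; yes; no; contradiction)
open import Relation.Nullary.Decidable using (dec-true)
open import Relation.Binary.PropositionalEquality

open Equivalence using (to; from)

private
  variable
    n k : ℕ

does≡true⇒ : ∀ {a} {A : Set a} (a? : Dec A) → does a? ≡ true → A
does≡true⇒ (yes a) _  = a
does≡true⇒ (no _)  ()

∧≡true⇔ : ∀ a b → a ∧ b ≡ true ⇔ (a ≡ true × b ≡ true)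
∧≡true⇔ a b = mk⇔ (λ h → ∧-conicalˡ a b h , ∧-conicalʳ a b h) λ { (refl , refl) → refl }

if≡true⇔ : ∀ b t → (if b then t else true) ≡ true ⇔ (b ≡ true → t ≡ true)
if≡true⇔ true  t = mk⇔ const (λ f → f refl)
if≡true⇔ false t = mk⇔ (λ _ ()) (const refl)

=ᵛ≡true⇔ : (xs ys : Vec Bool n) → (xs =ᵛ ys) ≡ true ⇔ xs ≡ ys
=ᵛ≡true⇔ xs ys = mk⇔ (does≡true⇒ (≡-dec _≟ᵇ_ xs ys)) (dec-true (≡-dec _≟ᵇ_ xs ys))

⟦⟧≤1 : ∀ b → ⟦ b ⟧ ≤ 1
⟦⟧≤1 true  = ≤-refl
⟦⟧≤1 false = z≤n

⟦⟧≡1⇔ : ∀ b → ⟦ b ⟧ ≡ 1 ⇔ b ≡ true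
⟦⟧≡1⇔ true  = mk⇔ (const refl) (const refl)
⟦⟧≡1⇔ false = mk⇔ (λ ()) (λ ())

*≡1⇒ : ∀ m m′ → m * m′ ≡ 1 → m ≡ 1 × m′ ≡ 1
*≡1⇒ m m′ h = m*n≡1⇒m≡1 m m′ h , m*n≡1⇒n≡1 m m′ h

∏-≤1 : ∀ {m} (f : Fin m → ℕ) → (∀ i → f i ≤ 1) → ∏ f ≤ 1
∏-≤1 {zero}  f f≤1 = ≤-refl
∏-≤1 {suc m} f f≤1 = *-mono-≤ (f≤1 zero) (∏-≤1 (f ∘ suc) (f≤1 ∘ suc))

∏≡1⇒∀≡1 : ∀ {m} (f : Fin m → ℕ) → ∏ f ≡ 1 → ∀ i → f i ≡ 1
∏≡1⇒∀≡1 {suc m} f h zero    = proj₁ (*≡1⇒ (f zero) (∏ (f ∘ suc)) h)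
∏≡1⇒∀≡1 {suc m} f h (suc i) = ∏≡1⇒∀≡1 (f ∘ suc) (proj₂ (*≡1⇒ (f zero) (∏ (f ∘ suc)) h)) i

∀≡1⇒∏≡1 : ∀ {m} (f : Fin m → ℕ) → (∀ i → f i ≡ 1) → ∏ f ≡ 1
∀≡1⇒∏≡1 {zero}  f h = refl
∀≡1⇒∏≡1 {suc m} f h = cong₂ _*_ (h zero) (∀≡1⇒∏≡1 (f ∘ suc) (h ∘ suc))

∏⟦⟧≡1⇔ : ∀ {m} (b : Fin m → Bool) → ∏ (λ i → ⟦ b i ⟧) ≡ 1 ⇔ (∀ i → b i ≡ true)
∏⟦⟧≡1⇔ b = mk⇔ (λ h i → to (⟦⟧≡1⇔ (b i)) (∏≡1⇒∀≡1 _ h i))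
                (λ h → ∀≡1⇒∏≡1 _ (λ i → from (⟦⟧≡1⇔ (b i)) (h i)))

IsOneHot : Vec Bool n → Set
IsOneHot {n} xs = ∃[ v ] xs ≡ oneHot {n} v

allFalse : ∀ n → Vec Bool n
allFalse n = tabulate (const false)

ones≡0⇒allFalse : (xs : Vec Bool n) → ones xs ≡ 0 → xs ≡ allFalse n
ones≡0⇒allFalse []           _ = refl
ones≡0⇒allFalse (false ∷ xs) h = cong (false ∷_) (ones≡0⇒allFalse xs h)

ones-allFalse : ∀ n → ones (allFalse n) ≡ 0
ones-allFalse zero    = refl
ones-allFalse (suc n) = ones-allFalse n

ones-oneHot : (v : Fin n) → ones (oneHot v) ≡ 1
ones-oneHot {suc n} zero    = cong suc (ones-allFalse n)
ones-oneHot {suc n} (suc v) = ones-oneHot v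

ones≡1⇒isOneHot : (xs : Vec Bool n) → ones xs ≡ 1 → IsOneHot xs
ones≡1⇒isOneHot (true  ∷ xs) h = zero , cong (true ∷_) (ones≡0⇒allFalse xs (suc-injective h))
ones≡1⇒isOneHot (false ∷ xs) h with ones≡1⇒isOneHot xs h
... | v , xs≡v = suc v , cong (false ∷_) xs≡v

HW₌₁≡true⇔isOneHot : (xs : Vec Bool n) → HW₌₁ xs ≡ true ⇔ IsOneHot xs
HW₌₁≡true⇔isOneHot xs = mk⇔
  (λ h → ones≡1⇒isOneHot xs (≡ᵇ⇒≡ (ones xs) 1 (from T-≡ h)))
  (λ { (v , refl) → cong (_≡ᵇ 1) (ones-oneHot v) })

tabulate≡oneHot⇒ : ∀ (g : Fin n → Bool) {v} → tabulate g ≡ oneHot v → ∀ t → g t ≡ does (t ≟ᶠ v)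
tabulate≡oneHot⇒ g {v} e t = begin
  g t                    ≡⟨ lookup∘tabulate g t ⟨
  lookup (tabulate g) t  ≡⟨ cong (λ xs → lookup xs t) e ⟩
  lookup (oneHot v) t    ≡⟨ lookup∘tabulate _ t ⟩
  does (t ≟ᶠ v)          ∎
  where open ≡-Reasoning

oneHot-injective : {u v : Fin n} → oneHot u ≡ oneHot v → u ≡ v
oneHot-injective {u = u} {v} e = does≡true⇒ (u ≟ᶠ v) (begin
  does (u ≟ᶠ v)  ≡⟨ tabulate≡oneHot⇒ _ e u ⟨
  does (u ≟ᶠ u)  ≡⟨ dec-true (u ≟ᶠ u) refl ⟩
  true           ∎)
  where open ≡-Reasoning

northOf eastOf southOf westOf : Assignment n k → Fin k → Fin k → Vec Bool n
northOf x i j = bundleV x j (inject₁ i)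
eastOf  x i j = bundleH x i (suc j)
southOf x i j = bundleV x j (suc i)
westOf  x i j = bundleH x i (inject₁ j)

record Satisfies (F : InnerFunctions n k) (x : Assignment n k) : Set where
  field
    inner       : ∀ i j → F i j (northOf x i j) (eastOf x i j) (southOf x i j) (westOf x i j) ≡ true
    northBorder : ∀ j → HW₌₁ (bundleV x j zero) ≡ true
    westBorder  : ∀ i → HW₌₁ (bundleH x i zero) ≡ true
    southBorder : ∀ j → HW₌₁ (bundleV x j (fromℕ k)) ≡ true
    eastBorder  : ∀ i → HW₌₁ (bundleH x i (fromℕ k)) ≡ true

val≤1 : (F : InnerFunctions n k) (x : Assignment n k) → val F x ≤ 1
val≤1 {k = k} F x =
  *-mono-≤ (*-mono-≤ (*-mono-≤ (*-mono-≤ (∏-≤1 _ (λ i → ∏⟦⟧≤1 (λ j → F i j _ _ _ _)))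
    (∏⟦⟧≤1 (λ j → HW₌₁ (bundleV x j zero))))
    (∏⟦⟧≤1 (λ i → HW₌₁ (bundleH x i zero))))
    (∏⟦⟧≤1 (λ j → HW₌₁ (bundleV x j (fromℕ k)))))
    (∏⟦⟧≤1 (λ i → HW₌₁ (bundleH x i (fromℕ k))))
  where
  ∏⟦⟧≤1 : ∀ {m} (b : Fin m → Bool) → ∏ (λ i → ⟦ b i ⟧) ≤ 1
  ∏⟦⟧≤1 b = ∏-≤1 _ (λ i → ⟦⟧≤1 (b i))

val≢0⇒val≡1 : (F : InnerFunctions n k) (x : Assignment n k) → val F x ≢ 0 → val F x ≡ 1
val≢0⇒val≡1 F x val≢0 with n≤1⇒n≡0∨n≡1 (val≤1 F x)
... | inj₁ val≡0 = contradiction val≡0 val≢0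
... | inj₂ val≡1 = val≡1

val≡1⇔satisfies : (F : InnerFunctions n k) (x : Assignment n k) → val F x ≡ 1 ⇔ Satisfies F x
val≡1⇔satisfies {n} {k} F x = mk⇔ satisfied valOne
  where
  open Satisfies

  innerBit : Fin k → Fin k → Bool
  innerBit i j = F i j (northOf x i j) (eastOf x i j) (southOf x i j) (westOf x i j)

  satisfied : val F x ≡ 1 → Satisfies F x
  satisfied val≡1 =
    let (≡1₄ , E) = *≡1⇒ _ _ val≡1
        (≡1₃ , S) = *≡1⇒ _ _ ≡1₄
        (≡1₂ , W) = *≡1⇒ _ _ ≡1₃
        (I   , N) = *≡1⇒ _ _ ≡1₂
    in record
      { inner       = λ i → to (∏⟦⟧≡1⇔ (innerBit i)) (∏≡1⇒∀≡1 _ I i)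
      ; northBorder = to (∏⟦⟧≡1⇔ _) N
      ; westBorder  = to (∏⟦⟧≡1⇔ _) W
      ; southBorder = to (∏⟦⟧≡1⇔ _) S
      ; eastBorder  = to (∏⟦⟧≡1⇔ _) E
      }

  valOne : Satisfies F x → val F x ≡ 1
  valOne sat =
    cong₂ _*_ (cong₂ _*_ (cong₂ _*_ (cong₂ _*_
      (∀≡1⇒∏≡1 _ (λ i → from (∏⟦⟧≡1⇔ (innerBit i)) (inner sat i)))
      (from (∏⟦⟧≡1⇔ _) (northBorder sat)))
      (from (∏⟦⟧≡1⇔ _) (westBorder sat)))
      (from (∏⟦⟧≡1⇔ _) (southBorder sat)))
      (from (∏⟦⟧≡1⇔ _) (eastBorder sat))

Fits : Cells k → Tiles n k → Fin k → Fin k → Fin n × Fin n → Set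
Fits C T i j t = C i j ≡ true → T i j t ≡ true

admissible-cell⇔ : {C : Cells k} {T : Tiles n k} {F : InnerFunctions n k} → Admissible C T F →
  ∀ i j vN vW xE xS →
  F i j (oneHot vN) xE xS (oneHot vW) ≡ true
    ⇔ (xS ≡ oneHot vN × xE ≡ oneHot vW × Fits C T i j (vW , vN))
admissible-cell⇔ {C = C} {T} {F} adm i j vN vW xE xS = mk⇔ sound complete
  where
  sound : F i j (oneHot vN) xE xS (oneHot vW) ≡ true → xS ≡ oneHot vN × xE ≡ oneHot vW × Fits C T i j (vW , vN)
  sound h =
    let (S , rest) = to (∧≡true⇔ _ _) (trans (sym (adm i j vN vW xE xS)) h)
        (E , fits) = to (∧≡true⇔ _ _) rest
    in sym (to (=ᵛ≡true⇔ _ _) S) , sym (to (=ᵛ≡true⇔ _ _) E) , to (if≡true⇔ (C i j) _) fits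

  complete : xS ≡ oneHot vN × xE ≡ oneHot vW × Fits C T i j (vW , vN) → F i j (oneHot vN) xE xS (oneHot vW) ≡ true
  complete (refl , refl , fits) = trans (adm i j vN vW xE xS)
    (from (∧≡true⇔ _ _) (from (=ᵛ≡true⇔ (oneHot vN) _) refl ,
      from (∧≡true⇔ _ _) (from (=ᵛ≡true⇔ (oneHot vW) _) refl , from (if≡true⇔ (C i j) _) fits)))

-- Boundary p separates cells p - 1 and p and its bundle encodes cell p - 1;
-- the western/northern border boundary 0 encodes cell 0.
precedingCell : Fin (suc (suc k)) → Fin (suc k)
precedingCell zero    = zero
precedingCell (suc j) = j

encode : Tiling n (suc k) → Assignment n (suc k)
encode a (hor i p t) = does (t ≟ᶠ proj₁ (a i (precedingCell p)))
encode a (ver j p t) = does (t ≟ᶠ proj₂ (a (precedingCell p) j))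

encode-cong : (a b : Tiling n (suc k)) → a ≗ᵀ b → encode a ≗ᴱ encode b
encode-cong a b a≗b (hor i p t) = cong (λ c → does (t ≟ᶠ proj₁ c)) (a≗b i (precedingCell p))
encode-cong a b a≗b (ver j p t) = cong (λ c → does (t ≟ᶠ proj₂ c)) (a≗b (precedingCell p) j)

encode-injective : (a b : Tiling n (suc k)) → encode a ≗ᴱ encode b → a ≗ᵀ b
encode-injective a b e i j = cong₂ _,_
  (oneHot-injective (tabulate-cong (λ t → e (hor i (suc j) t))))
  (oneHot-injective (tabulate-cong (λ t → e (ver j (suc i) t))))

suc≡inject₁ : (j j′ : Fin k) → toℕ j′ ≡ suc (toℕ j) → suc j ≡ inject₁ j′
suc≡inject₁ j j′ e = toℕ-injective (trans (sym e) (sym (toℕ-inject₁ j′)))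

module _ {C : Cells (suc k)} {T : Tiles n (suc k)} {a : Tiling n (suc k)} (grid : IsGridTiling C T a) where
  open IsGridTiling grid

  proj₁-precedingCell : ∀ i j → proj₁ (a i (precedingCell (inject₁ j))) ≡ proj₁ (a i j)
  proj₁-precedingCell i zero    = refl
  proj₁-precedingCell i (suc j) = horiz i (inject₁ j) (suc j) (cong suc (sym (toℕ-inject₁ j)))

  proj₂-precedingCell : ∀ i j → proj₂ (a (precedingCell (inject₁ i)) j) ≡ proj₂ (a i j)
  proj₂-precedingCell zero    j = refl
  proj₂-precedingCell (suc i) j = vert (inject₁ i) (suc i) j (cong suc (sym (toℕ-inject₁ i)))

  encode-satisfies : {F : InnerFunctions n (suc k)} → Admissible C T F → Satisfies F (encode a)
  encode-satisfies {F} adm = record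
    { inner       = inner
    ; northBorder = λ j → oneHotBorder _
    ; westBorder  = λ i → oneHotBorder _
    ; southBorder = λ j → oneHotBorder _
    ; eastBorder  = λ i → oneHotBorder _
    }
    where
    oneHotBorder : (v : Fin n) → HW₌₁ (oneHot v) ≡ true
    oneHotBorder v = from (HW₌₁≡true⇔isOneHot (oneHot v)) (v , refl)

    inner : ∀ i j → F i j (northOf (encode a) i j) (eastOf (encode a) i j)
                          (southOf (encode a) i j) (westOf (encode a) i j) ≡ true
    inner i j = subst₂ (λ vN vW → F i j (oneHot vN) (oneHot W) (oneHot N) (oneHot vW) ≡ true)
      (sym (proj₂-precedingCell i j)) (sym (proj₁-precedingCell i j))
      (from (admissible-cell⇔ {C = C} {T} {F} adm i j N W (oneHot W) (oneHot N)) (refl , refl , tiles i j))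
      where
      W = proj₁ (a i j)
      N = proj₂ (a i j)

module Decode {C : Cells (suc k)} {T : Tiles n (suc k)} {F : InnerFunctions n (suc k)}
              (adm : Admissible C T F) {x : Assignment n (suc k)} (sat : Satisfies F x) where
  open Satisfies sat

  propagate : ∀ i j {vN vW} → northOf x i j ≡ oneHot vN → westOf x i j ≡ oneHot vW →
    southOf x i j ≡ oneHot vN × eastOf x i j ≡ oneHot vW × Fits C T i j (vW , vN)
  propagate i j {vN} {vW} eN eW = to (admissible-cell⇔ {C = C} {T} {F} adm i j vN vW _ _)
    (subst₂ (λ xN xW → F i j xN (eastOf x i j) (southOf x i j) xW ≡ true) eN eW (inner i j))

  westOneHot : ∀ i → (∀ j → IsOneHot (northOf x i j)) → ∀ j → IsOneHot (westOf x i j)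
  westOneHot i northOneHot = <-weakInduction (IsOneHot ∘ westOf x i)
    (to (HW₌₁≡true⇔isOneHot _) (westBorder i))
    (λ j (vW , eW) → let (vN , eN) = northOneHot (inject₁ j) in
      vW , proj₁ (proj₂ (propagate i (inject₁ j) eN eW)))

  northOneHot : ∀ i j → IsOneHot (northOf x i j)
  northOneHot = <-weakInduction (λ i → ∀ j → IsOneHot (northOf x i j))
    (λ j → to (HW₌₁≡true⇔isOneHot _) (northBorder j))
    (λ i northOneHotᵢ j → let (vN , eN) = northOneHotᵢ j
                              (vW , eW) = westOneHot (inject₁ i) northOneHotᵢ j in
      vN , proj₁ (propagate (inject₁ i) j eN eW))

  decoded : Tiling n (suc k)
  decoded i j = proj₁ (westOneHot i (northOneHot i) j) , proj₁ (northOneHot i j)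

  west-decoded : ∀ i j → westOf x i j ≡ oneHot (proj₁ (decoded i j))
  west-decoded i j = proj₂ (westOneHot i (northOneHot i) j)

  north-decoded : ∀ i j → northOf x i j ≡ oneHot (proj₂ (decoded i j))
  north-decoded i j = proj₂ (northOneHot i j)

  propagate-decoded : ∀ i j → southOf x i j ≡ oneHot (proj₂ (decoded i j))
                            × eastOf x i j ≡ oneHot (proj₁ (decoded i j))
                            × Fits C T i j (decoded i j)
  propagate-decoded i j = propagate i j (north-decoded i j) (west-decoded i j)

  decoded-isGridTiling : IsGridTiling C T decoded
  decoded-isGridTiling = record
    { horiz = λ i j j′ e → oneHot-injective (begin
        oneHot (proj₁ (decoded i j))   ≡⟨ proj₁ (proj₂ (propagate-decoded i j)) ⟨
        bundleH x i (suc j)            ≡⟨ cong (bundleH x i) (suc≡inject₁ j j′ e) ⟩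
        westOf x i j′                  ≡⟨ west-decoded i j′ ⟩
        oneHot (proj₁ (decoded i j′))  ∎)
    ; vert = λ i i′ j e → oneHot-injective (begin
        oneHot (proj₂ (decoded i j))   ≡⟨ proj₁ (propagate-decoded i j) ⟨
        bundleV x j (suc i)            ≡⟨ cong (bundleV x j) (suc≡inject₁ i i′ e) ⟩
        northOf x i′ j                 ≡⟨ north-decoded i′ j ⟩
        oneHot (proj₂ (decoded i′ j))  ∎)
    ; tiles = λ i j → proj₂ (proj₂ (propagate-decoded i j))
    }
    where open ≡-Reasoning

  encode-decoded : encode decoded ≗ᴱ x
  encode-decoded (hor i zero    t) = sym (tabulate≡oneHot⇒ _ (west-decoded i zero) t)
  encode-decoded (hor i (suc j) t) = sym (tabulate≡oneHot⇒ _ (proj₁ (proj₂ (propagate-decoded i j))) t)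
  encode-decoded (ver j zero    t) = sym (tabulate≡oneHot⇒ _ (north-decoded zero j) t)
  encode-decoded (ver j (suc i) t) = sym (tabulate≡oneHot⇒ _ (proj₁ (propagate-decoded i j)) t)

noEdges : Edge n 0 → ⊥
noEdges (hor () _ _)
noEdges (ver () _ _)

lemma28 : (n k : ℕ) (C : Cells k) (T : Tiles n k) (F : InnerFunctions n k) →
    Admissible C T F →
    Σ (Tiling n k → Assignment n k) (λ φ →
        (∀ a b → a ≗ᵀ b → φ a ≗ᴱ φ b)
      × (∀ a → IsGridTiling C T a → val F (φ a) ≢ 0)
      × (∀ a b → IsGridTiling C T a → IsGridTiling C T b → φ a ≗ᴱ φ b → a ≗ᵀ b)
      × (∀ x → val F x ≢ 0 → Σ (Tiling n k) (λ a → IsGridTiling C T a × φ a ≗ᴱ x)))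
    × (∀ (x : Assignment n k) → val F x ≢ 0 → val F x ≡ 1)
lemma28 n zero C T F adm =
    ( (λ _ → ⊥-elim ∘ noEdges)
    , (λ _ _ _ → ⊥-elim ∘ noEdges)
    , (λ _ _ ())
    , (λ _ _ _ _ _ ())
    , (λ _ _ → (λ ()) , record { horiz = λ () ; vert = λ () ; tiles = λ () } , ⊥-elim ∘ noEdges) )
  , val≢0⇒val≡1 F
lemma28 n (suc k) C T F adm =
    ( encode
    , encode-cong
    , (λ a grid val≡0 → 1+n≢0 (trans (sym (valOne a grid)) val≡0))
    , (λ a b _ _ → encode-injective a b)
    , decode )
  , val≢0⇒val≡1 F
  where
  valOne : ∀ a → IsGridTiling C T a → val F (encode a) ≡ 1
  valOne a grid = from (val≡1⇔satisfies F (encode a)) (encode-satisfies grid adm)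

  decode : ∀ x → val F x ≢ 0 → Σ (Tiling n (suc k)) (λ a → IsGridTiling C T a × encode a ≗ᴱ x)
  decode x val≢0 = decoded , decoded-isGridTiling , encode-decoded
    where open Decode {C = C} {T} {F} adm (to (val≡1⇔satisfies F x) (val≢0⇒val≡1 F x val≢0))
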